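{- $p(n)=\Theta(\log\log n)$ as $n\to\infty$.
   Context: A phylogenetic tree on $[n]$ is a rooted binary tree whose leaves are labelled bijectively by $[n]$. A phylogenetic triplet $(a|b,c)$ is given by three distinct $a,b,c\in[n]$. A phylogenetic tree is consistent with $(a|b,c)$ if the path from the leaf labelled $a$ to the root does not intersect the path between the leaves labelled $b$ and $c$. $p(n)$ is the minimum size of a set $\mathcal T$ of phylogenetic trees on $[n]$ such that every triplet $(a|b,c)$ is consistent with at least one tree in $\mathcal T$. -}

module Defs where

open import Data.Nat using (ℕ; _*_; _≤_)
open import Data.Nat.Logarithm using (⌊log₂_⌋)
open import Data.Bool using (Bool; true; false)
open import Data.Fin using (Fin)
open import Data.List using (List; []; _∷_; _++_; length; allFin)
open import Data.List.Relation.Unary.All using (All)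
open import Data.List.Relation.Unary.Any using (Any)
open import Data.List.Relation.Binary.Permutation.Propositional using (_↭_)
open import Data.Product using (Σ; ∃; ∃-syntax; _×_)
open import Data.Sum using (_⊎_)
open import Relation.Binary.PropositionalEquality using (_≡_; _≢_)
open import Relation.Nullary using (¬_)

data Tree (A : Set) : Set where
  leaf : A → Tree A
  node : Tree A → Tree A → Tree A

leaves : {A : Set} → Tree A → List A
leaves (leaf a)   = a ∷ []
leaves (node l r) = leaves l ++ leaves r

IsPhylo : (n : ℕ) → Tree (Fin n) → Set
IsPhylo n t = leaves t ↭ allFin n

-- Nodes of a tree are addressed by the path from the root
-- (false = left child, true = right child).
Addr : Set
Addr = List Bool

data LeafAt {A : Set} : Tree A → Addr → A → Set where
  here  : ∀ {a} → LeafAt (leaf a) [] a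
  left  : ∀ {l r p a} → LeafAt l p a → LeafAt (node l r) (false ∷ p) a
  right : ∀ {l r p a} → LeafAt r p a → LeafAt (node l r) (true ∷ p) a

-- q is an ancestor-or-equal of p (q is a prefix of p)
_≼_ : Addr → Addr → Set
q ≼ p = ∃[ s ] (q ++ s ≡ p)

OnRootPath : Addr → Addr → Set
OnRootPath p q = q ≼ p

-- q lies on the path between the nodes pb and pc: q is an ancestor-or-equal
-- of pb or of pc, and a descendant-or-equal of their lowest common ancestor
-- (i.e. of every common ancestor of pb and pc).
OnPath : Addr → Addr → Addr → Set
OnPath pb pc q = ((q ≼ pb) ⊎ (q ≼ pc)) × (∀ r → r ≼ pb → r ≼ pc → r ≼ q)

Distinct3 : {n : ℕ} → Fin n → Fin n → Fin n → Set
Distinct3 a b c = (a ≢ b) × (a ≢ c) × (b ≢ c)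

ConsistentWith : {n : ℕ} → Tree (Fin n) → Fin n → Fin n → Fin n → Set
ConsistentWith t a b c =
  ∀ pa pb pc → LeafAt t pa a → LeafAt t pb b → LeafAt t pc c →
  ¬ (∃[ q ] (OnRootPath pa q × OnPath pb pc q))

Covers : (n : ℕ) → List (Tree (Fin n)) → Set
Covers n T = ∀ (a b c : Fin n) → Distinct3 a b c →
  Any (λ t → ConsistentWith t a b c) T

-- A valid family: a list of phylogenetic trees on [n] covering all triplets.
-- (A set of k trees is the same as a duplicate-free list of length k; allowing
-- duplicates does not change the minimum.)
ValidFamily : (n : ℕ) → List (Tree (Fin n)) → Set
ValidFamily n T = All (IsPhylo n) T × Covers n T

-- integer version of log log n (base 2); Θ is insensitive to floors/base.
loglog : ℕ → ℕ
loglog n = ⌊log₂ ⌊log₂ n ⌋ ⌋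

module Submission where

-- Both directions rest on the left-to-right order ◁ of the nodes of a tree:
-- (1) if the leaf a lies strictly between the leaves b and c, the root path of a meets
--     the path from b to c, so the tree is not consistent with (a|b,c) (◁-between);
-- (2) a caterpillar whose leaves are sorted by a key, largest key next to the root, is
--     consistent with (a|b,c) whenever a has a larger key than b and c (keyTree).
-- Upper bound.  A list of self-maps of [0,M) is separating if each element of each triple
-- of distinct points is ranked strictly on top by one of them.  Lexicographic products
-- square M at the cost of four more maps (square-separating), so m k = 2^(2^k) has a
-- separating family of size 4k, and (2) turns it into trees (treesFromKeys).
-- Lower bound.  Each tree ranks the leaves by ◁.  Erdős–Szekeres, proved by patience
-- sorting and iterated over k rankings (monotoneSublist), finds among m (k + 1) leaves four
-- that are monotone in every ranking; by (1) the second of them is never on top (lowerBound).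
-- The theorem follows from n ≤ m k ⇒ loglog n ≤ k and n ≤ m (1 + loglog n).

open import Defs
open import Data.Nat using (ℕ; zero; suc; _+_; _*_; _∸_; _^_; _≤_; _<_; _≟_; _≤?_; z≤n; s≤s; NonZero)
open import Data.Nat.Properties
  using ( ≤-refl; ≤-trans; ≤-pred; <-≤-trans; <⇒≤; ≰⇒>; <⇒≱; <-irrefl; <-cmp; n<1+n
        ; m≤m+n; +-comm; +-suc; +-identityʳ; +-monoʳ-≤; +-monoˡ-≤; +-mono-≤; +-monoʳ-<
        ; *-suc; *-monoˡ-≤; *-monoʳ-≤; *-mono-<; *-distribʳ-+; m∸n≤m; ∸-monoʳ-<
        ; ^-distribˡ-+-*; ^-monoʳ-≤; m^n≢0; module ≤-Reasoning; ≤-decTotalOrder )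
open import Data.Nat.DivMod using (_/_; _%_; m≡m%n+[m/n]*n; m%n<n; m<n*o⇒m/o<n)
open import Data.Nat.Logarithm using (⌊log₂_⌋; ⌊log₂⌋-mono-≤; ⌊log₂[2^n]⌋≡n)
open import Data.Bool using (Bool; true; false)
open import Data.Fin using (Fin; toℕ)
open import Data.Fin.Properties using (toℕ<n; toℕ-injective)
open import Data.List using (List; []; _∷_; _++_; length; map; allFin)
open import Data.Nat.ListAction using (sum)
open import Data.List.Properties using (∷-injective; length-map; length-++; length-tabulate)
open import Data.List.Relation.Unary.All as All using (All; []; _∷_)
open import Data.List.Relation.Unary.Any as Any using (Any; here; there; any?)
import Data.List.Relation.Unary.Any.Properties as Anyₚ
import Data.List.Relation.Unary.All.Properties as Allₚ
open import Data.List.Relation.Unary.AllPairs using (AllPairs; []; _∷_)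
open import Data.List.Relation.Unary.Linked using (Linked; _∷_)
open import Data.List.Relation.Unary.Unique.Propositional using (Unique)
open import Data.List.Relation.Unary.Unique.Propositional.Properties using (allFin⁺)
open import Data.List.Relation.Binary.Sublist.Propositional using (_⊆_; []; _∷_; _∷ʳ_; ⊆-refl; ⊆-trans; minimum)
open import Data.List.Relation.Binary.Sublist.Propositional.Properties using (All-resp-⊆)
open import Data.List.Relation.Binary.Permutation.Propositional using (_↭_; ↭-refl; ↭-sym; ↭-trans)
open import Data.List.Relation.Binary.Permutation.Propositional.Properties using (++⁺ʳ; ∷↭∷ʳ; ∈-resp-↭; ¬x∷xs↭[])
open import Data.List.Membership.Propositional using (_∈_; lose)
open import Data.List.Membership.Propositional.Properties using (∈-++⁻; ∈-allFin)
open import Data.Product using (∃-syntax; _×_; _,_; proj₁; proj₂)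
open import Data.Sum using (_⊎_; inj₁; inj₂)
import Data.Sum as Sum
open import Data.Unit using (⊤; tt)
open import Data.Empty using (⊥-elim)
open import Function using (_∘_; flip)
open import Relation.Binary.PropositionalEquality using (_≡_; _≢_; refl; sym; trans; cong; cong₂; subst; subst₂; module ≡-Reasoning)
open import Relation.Nullary using (¬_; Dec; yes; no)
open import Relation.Nullary.Decidable using (map′)
open import Relation.Binary.Definitions using (tri<; tri≈; tri>)
import Relation.Binary.Construct.On as On
import Relation.Binary.Construct.Flip.EqAndOrd as Flip

[]-≼ : ∀ p → [] ≼ p
[]-≼ p = p , refl

∷-≼ : ∀ {r p} d → r ≼ p → (d ∷ r) ≼ (d ∷ p)
∷-≼ d (s , r++s≡p) = s , cong (d ∷_) r++s≡p

∷-≼⁻ : ∀ {d d' r p} → (d ∷ r) ≼ (d' ∷ p) → d ≡ d' × r ≼ p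
∷-≼⁻ (s , eq) = proj₁ (∷-injective eq) , (s , proj₂ (∷-injective eq))

≼-∷-view : ∀ {r d p} → r ≼ (d ∷ p) → r ≡ [] ⊎ ∃[ r' ] (r ≡ d ∷ r' × r' ≼ p)
≼-∷-view {[]} _ = inj₁ refl
≼-∷-view {_ ∷ r'} r≼ with ∷-≼⁻ r≼
... | refl , r'≼ = inj₂ (r' , refl , r'≼)

OnPath-∷ : ∀ {pb pc q} d → OnPath pb pc q → OnPath (d ∷ pb) (d ∷ pc) (d ∷ q)
OnPath-∷ {pb} {pc} {q} d (side , lowest) = Sum.map (∷-≼ d) (∷-≼ d) side , lowest′
  where
  lowest′ : ∀ r → r ≼ (d ∷ pb) → r ≼ (d ∷ pc) → r ≼ (d ∷ q)
  lowest′ r r≼b r≼c with ≼-∷-view r≼b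
  ... | inj₁ refl = []-≼ _
  ... | inj₂ (r' , refl , r'≼pb) = ∷-≼ d (lowest r' r'≼pb (proj₂ (∷-≼⁻ r≼c)))

OnPath-∷⁻ : ∀ {d pb pc q} → OnPath (d ∷ pb) (d ∷ pc) q → ∃[ q' ] (q ≡ d ∷ q' × OnPath pb pc q')
OnPath-∷⁻ {d} {pb} {pc} (side , lowest) with lowest (d ∷ []) (∷-≼ d ([]-≼ pb)) (∷-≼ d ([]-≼ pc))
... | q' , refl = q' , refl , Sum.map (proj₂ ∘ ∷-≼⁻) (proj₂ ∘ ∷-≼⁻) side , lowest′
  where
  lowest′ : ∀ r → r ≼ pb → r ≼ pc → r ≼ q'
  lowest′ r r≼b r≼c = proj₂ (∷-≼⁻ (lowest (d ∷ r) (∷-≼ d r≼b) (∷-≼ d r≼c)))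

OnPath-sym : ∀ {pb pc q} → OnPath pb pc q → OnPath pc pb q
OnPath-sym (side , lowest) = Sum.swap side , λ r r≼c r≼b → lowest r r≼b r≼c

OnPath-fork : ∀ {pb pc} → OnPath (false ∷ pb) (true ∷ pc) []
OnPath-fork {pb} {pc} = inj₁ ([]-≼ _) , lowest
  where
  lowest : ∀ r → r ≼ (false ∷ pb) → r ≼ (true ∷ pc) → r ≼ []
  lowest [] _ _ = []-≼ []
  lowest (_ ∷ _) r≼b r≼c with ∷-≼⁻ r≼b | ∷-≼⁻ r≼c
  ... | refl , _ | () , _

Meets : Addr → Addr → Addr → Set
Meets pa pb pc = ∃[ q ] (OnRootPath pa q × OnPath pb pc q)

Consistent : {A : Set} → Tree A → A → A → A → Set
Consistent t a b c = ∀ pa pb pc → LeafAt t pa a → LeafAt t pb b → LeafAt t pc c → ¬ Meets pa pb pc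

meets-∷ : ∀ {pa pb pc} d → Meets pa pb pc → Meets (d ∷ pa) (d ∷ pb) (d ∷ pc)
meets-∷ d (q , q≼pa , on) = d ∷ q , ∷-≼ d q≼pa , OnPath-∷ d on

meets-∷⁻ : ∀ {pa d pb pc} → Meets pa (d ∷ pb) (d ∷ pc) → ∃[ pa' ] (pa ≡ d ∷ pa' × Meets pa' pb pc)
meets-∷⁻ (q , q≼pa , on) with OnPath-∷⁻ on | q≼pa
... | q' , refl , on' | s , refl = q' ++ s , refl , q' , (s , refl) , on'

meets-sym : ∀ {pa pb pc} → Meets pa pb pc → Meets pa pc pb
meets-sym (q , q≼pa , on) = q , q≼pa , OnPath-sym on

meets-fork : ∀ {pa pb pc} → Meets pa (false ∷ pb) (true ∷ pc)
meets-fork {pa} = [] , []-≼ pa , OnPath-fork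

data _◁_ : Addr → Addr → Set where
  fork : ∀ {p q} → (false ∷ p) ◁ (true ∷ q)
  step : ∀ {d p q} → p ◁ q → (d ∷ p) ◁ (d ∷ q)

step⁻ : ∀ {d p q} → (d ∷ p) ◁ (d ∷ q) → p ◁ q
step⁻ (step p◁q) = p◁q

◁-trans : ∀ {p q r} → p ◁ q → q ◁ r → p ◁ r
◁-trans fork (step _) = fork
◁-trans (step _) fork = fork
◁-trans (step p◁q) (step q◁r) = step (◁-trans p◁q q◁r)

_◁?_ : ∀ p q → Dec (p ◁ q)
[] ◁? _ = no λ ()
(_ ∷ _) ◁? [] = no λ ()
(false ∷ p) ◁? (true ∷ q) = yes fork
(true ∷ p) ◁? (false ∷ q) = no λ ()
(false ∷ p) ◁? (false ∷ q) = map′ step step⁻ (p ◁? q)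
(true ∷ p) ◁? (true ∷ q) = map′ step step⁻ (p ◁? q)

◁-between : ∀ {pa pb pc} → pb ◁ pa → pa ◁ pc → Meets pa pb pc
◁-between fork (step _) = meets-fork
◁-between (step _) fork = meets-fork
◁-between (step pb◁pa) (step pa◁pc) = meets-∷ _ (◁-between pb◁pa pa◁pc)

leaves-◁ : ∀ {A : Set} {t : Tree A} {p q a b} → LeafAt t p a → LeafAt t q b → a ≢ b → p ◁ q ⊎ q ◁ p
leaves-◁ here here a≢a = ⊥-elim (a≢a refl)
leaves-◁ (left _) (right _) _ = inj₁ fork
leaves-◁ (right _) (left _) _ = inj₂ fork
leaves-◁ (left la) (left lb) a≢b = Sum.map step step (leaves-◁ la lb a≢b)
leaves-◁ (right la) (right lb) a≢b = Sum.map step step (leaves-◁ la lb a≢b)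

leafAt : ∀ {A : Set} (t : Tree A) {x} → x ∈ leaves t → ∃[ p ] LeafAt t p x
leafAt (leaf _) (here refl) = [] , here
leafAt (node l r) x∈ with ∈-++⁻ (leaves l) x∈
... | inj₁ x∈l = let (p , at) = leafAt l x∈l in false ∷ p , left at
... | inj₂ x∈r = let (p , at) = leafAt r x∈r in true ∷ p , right at

module Caterpillar {A : Set} (key : A → ℕ) where

  caterpillar : A → List A → Tree A
  caterpillar x [] = leaf x
  caterpillar x (y ∷ ys) = node (caterpillar y ys) (leaf x)

  leaves-caterpillar : ∀ x ys → leaves (caterpillar x ys) ↭ x ∷ ys
  leaves-caterpillar x [] = ↭-refl
  leaves-caterpillar x (y ∷ ys) =
    ↭-trans (++⁺ʳ (x ∷ []) (leaves-caterpillar y ys)) (↭-sym (∷↭∷ʳ x (y ∷ ys)))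

  Descending : List A → Set
  Descending = Linked (λ u v → key v ≤ key u)

  key-≤-top : ∀ {x ys p a} → Descending (x ∷ ys) → LeafAt (caterpillar x ys) p a → key a ≤ key x
  key-≤-top {ys = []} _ here = ≤-refl
  key-≤-top {ys = _ ∷ _} _ (right here) = ≤-refl
  key-≤-top {ys = _ ∷ _} (y≤x ∷ desc) (left at) = ≤-trans (key-≤-top desc at) y≤x

  below-top : ∀ {x y ys p a b} → LeafAt (node (caterpillar y ys) (leaf x)) p b →
    key b < key a → key a ≤ key x → ∃[ p' ] (p ≡ false ∷ p' × LeafAt (caterpillar y ys) p' b)
  below-top (left at) _ _ = _ , refl , at
  below-top (right here) b<a a≤x = ⊥-elim (<-irrefl refl (<-≤-trans b<a a≤x))

  -- Descending caterpillars are consistent with (a|b,c) whenever a has the largest key: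
  -- b and c lie in the left subtree, and so does a, else the root path of a avoids it.
  caterpillar-consistent : ∀ {x ys a b c} → Descending (x ∷ ys) →
    key b < key a → key c < key a → Consistent (caterpillar x ys) a b c
  caterpillar-consistent {ys = []} _ b<a _ _ _ _ here here _ _ = <-irrefl refl b<a
  caterpillar-consistent {ys = _ ∷ _} desc b<a c<a pa pb pc at-a at-b at-c meets
    with below-top at-b b<a (key-≤-top desc at-a) | below-top at-c c<a (key-≤-top desc at-a)
  ... | pb' , refl , at-b' | pc' , refl , at-c' with meets-∷⁻ meets | at-a | desc
  ... | pa' , refl , meets' | left at-a' | _ ∷ desc' =
    caterpillar-consistent desc' b<a c<a pa' pb' pc' at-a' at-b' at-c' meets'

  open import Data.List.Sort (On.decTotalOrder (Flip.decTotalOrder ≤-decTotalOrder) key)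
    using (sort; sort-↭; sort-↗)

  keyTree : ∀ x xs → ∃[ t ] (leaves t ↭ x ∷ xs ×
    (∀ {a b c} → key b < key a → key c < key a → Consistent t a b c))
  keyTree x xs with sort (x ∷ xs) | sort-↭ (x ∷ xs) | sort-↗ (x ∷ xs)
  ... | [] | []↭ | _ = ⊥-elim (¬x∷xs↭[] (↭-sym []↭))
  ... | y ∷ ys | sorted↭ | desc =
    caterpillar y ys , ↭-trans (leaves-caterpillar y ys) sorted↭ , caterpillar-consistent desc

MapsBelow : ℕ → (ℕ → ℕ) → Set
MapsBelow M f = ∀ {x} → x < M → f x < M

Tops : ℕ → (ℕ → ℕ) → ℕ → ℕ → ℕ → Set
Tops M f a b c = MapsBelow M f × f b < f a × f c < f a

Separating : ℕ → List (ℕ → ℕ) → Set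
Separating M fs = ∀ {a b c} → a < M → b < M → c < M → a ≢ b → a ≢ c → b ≢ c →
  Any (λ f → Tops M f a b c) fs

-- No three distinct numbers lie below 2, so the empty family separates [0, 2).
separating-2 : Separating 2 []
separating-2 {0} {0} _ _ _ a≢b _ _ = ⊥-elim (a≢b refl)
separating-2 {1} {1} _ _ _ a≢b _ _ = ⊥-elim (a≢b refl)
separating-2 {0} {1} {0} _ _ _ _ a≢c _ = ⊥-elim (a≢c refl)
separating-2 {1} {0} {1} _ _ _ _ a≢c _ = ⊥-elim (a≢c refl)
separating-2 {0} {1} {1} _ _ _ _ _ b≢c = ⊥-elim (b≢c refl)
separating-2 {1} {0} {0} _ _ _ _ _ b≢c = ⊥-elim (b≢c refl)
separating-2 {_} {_} {suc (suc _)} _ _ (s≤s (s≤s ())) _ _ _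
separating-2 {suc (suc _)} (s≤s (s≤s ())) _ _ _ _ _
separating-2 {_} {suc (suc _)} _ (s≤s (s≤s ())) _ _ _ _

orient : Bool → ℕ → ℕ → ℕ
orient true M x = x
orient false M x = M ∸ suc x

orient-below : ∀ {M} e → MapsBelow M (orient e M)
orient-below true x<M = x<M
orient-below {suc M} false {x} _ = s≤s (m∸n≤m M x)

orient-choose : ∀ {M x y} → x < M → y < M → x ≢ y → ∃[ e ] (orient e M y < orient e M x)
orient-choose {M} {x} {y} _ y<M x≢y with <-cmp x y
... | tri< x<y _ _ = false , ∸-monoʳ-< {M} (s≤s x<y) y<M
... | tri≈ _ x≡y _ = ⊥-elim (x≢y x≡y)
... | tri> _ _ y<x = true , y<x

digits-< : ∀ {M p q r s} → p < q → r < M → p * M + r < q * M + s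
digits-< {M} {p} {q} {r} {s} p<q r<M = begin-strict
  p * M + r   <⟨ +-monoʳ-< (p * M) r<M ⟩
  p * M + M   ≡⟨ +-comm (p * M) M ⟩
  suc p * M   ≤⟨ *-monoˡ-≤ M p<q ⟩
  q * M       ≤⟨ m≤m+n (q * M) s ⟩
  q * M + s   ∎
  where open ≤-Reasoning

digits-<-square : ∀ {M p r} → p < M → r < M → p * M + r < M * M
digits-<-square {M} {p} {r} p<M r<M =
  subst (p * M + r <_) (+-identityʳ (M * M)) (digits-< {s = 0} p<M r<M)

digits-injective : ∀ {M x y} .{{_ : NonZero M}} → x / M ≡ y / M → x % M ≡ y % M → x ≡ y
digits-injective {M} {x} {y} high≡ low≡ = begin
  x                      ≡⟨ m≡m%n+[m/n]*n x M ⟩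
  x % M + (x / M) * M    ≡⟨ cong₂ (λ u v → u + v * M) low≡ high≡ ⟩
  y % M + (y / M) * M    ≡⟨ m≡m%n+[m/n]*n y M ⟨
  y                      ∎
  where open ≡-Reasoning

lex : (M : ℕ) .{{_ : NonZero M}} → (ℕ → ℕ) → (ℕ → ℕ) → ℕ → ℕ
lex M σ τ x = σ (x / M) * M + τ (x % M)

lex-below : ∀ {M σ τ} .{{_ : NonZero M}} → MapsBelow M σ → MapsBelow M τ → MapsBelow (M * M) (lex M σ τ)
lex-below {M} σ< τ< {x} x<M² = digits-<-square (σ< (m<n*o⇒m/o<n x<M²)) (τ< (m%n<n x M))

LexAbove : (M : ℕ) .{{_ : NonZero M}} → (ℕ → ℕ) → (ℕ → ℕ) → ℕ → ℕ → Set
LexAbove M σ τ a b = σ (b / M) < σ (a / M) ⊎ (b / M ≡ a / M × τ (b % M) < τ (a % M))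

lex-< : ∀ {M} .{{_ : NonZero M}} σ τ {a b} → MapsBelow M τ → LexAbove M σ τ a b → lex M σ τ b < lex M σ τ a
lex-< {M} σ τ {b = b} τ< (inj₁ high<) = digits-< high< (τ< (m%n<n b M))
lex-< {M} σ τ {a} {b} _ (inj₂ (high≡ , low<)) =
  subst (λ u → σ u * M + τ (b % M) < lex M σ τ a) (sym high≡) (+-monoʳ-< (σ (a / M) * M) low<)

oriented : (M : ℕ) .{{_ : NonZero M}} → Bool → Bool → ℕ → ℕ
oriented M e₁ e₂ = lex M (orient e₁ M) (orient e₂ M)

orientations : (M : ℕ) .{{_ : NonZero M}} → List (ℕ → ℕ)
orientations M = oriented M true true ∷ oriented M true false ∷
                 oriented M false true ∷ oriented M false false ∷ []

∈-orientations : ∀ {M} .{{_ : NonZero M}} e₁ e₂ → oriented M e₁ e₂ ∈ orientations M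
∈-orientations true true = here refl
∈-orientations true false = there (here refl)
∈-orientations false true = there (there (here refl))
∈-orientations false false = there (there (there (here refl)))

square : (M : ℕ) .{{_ : NonZero M}} → List (ℕ → ℕ) → List (ℕ → ℕ)
square M fs = map (λ σ → lex M σ σ) fs ++ orientations M

length-square : ∀ {M} .{{_ : NonZero M}} fs → length (square M fs) ≡ length fs + 4
length-square {M} fs = trans (length-++ (map (λ σ → lex M σ σ) fs)) (cong (_+ 4) (length-map _ fs))

-- If a, b, c agree in the
-- high digit, the family separates the low digits; if their high digits are distinct, it
-- separates the high digits.  Otherwise an orientation on each digit suffices: a must beat
-- the points sharing its high digit on the low digit, and the others on the high digit.
square-separating : ∀ {M fs} .{{_ : NonZero M}} → Separating M fs → Separating (M * M) (square M fs)
square-separating {M} {fs} sep {a} {b} {c} a<M² b<M² c<M² a≢b a≢c b≢c = byHighDigits (a₁ ≟ b₁) (a₁ ≟ c₁)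
  where
  a₁ = a / M
  b₁ = b / M
  c₁ = c / M

  Goal : Set
  Goal = Any (λ f → Tops (M * M) f a b c) (square M fs)

  high< : ∀ {x} → x < M * M → x / M < M
  high< = m<n*o⇒m/o<n

  low< : ∀ x → x % M < M
  low< x = m%n<n x M

  low-≢ : ∀ {x y} → x / M ≡ y / M → x ≢ y → x % M ≢ y % M
  low-≢ high≡ x≢y low≡ = x≢y (digits-injective high≡ low≡)

  viaDiagonal : Any (λ σ → Tops (M * M) (lex M σ σ) a b c) fs → Goal
  viaDiagonal = Anyₚ.++⁺ˡ ∘ Anyₚ.map⁺

  viaOrientation : ∀ e₁ e₂ → LexAbove M (orient e₁ M) (orient e₂ M) a b →
    LexAbove M (orient e₁ M) (orient e₂ M) a c → Goal
  viaOrientation e₁ e₂ b<a c<a = Anyₚ.++⁺ʳ (map (λ σ → lex M σ σ) fs) (lose (∈-orientations e₁ e₂)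
    (lex-below (orient-below e₁) (orient-below e₂) , lex-< σ τ τ< b<a , lex-< σ τ τ< c<a))
    where
    σ = orient e₁ M
    τ = orient e₂ M
    τ< = orient-below e₂

  byHighDigits : Dec (a₁ ≡ b₁) → Dec (a₁ ≡ c₁) → Goal
  byHighDigits (yes a₁≡b₁) (yes a₁≡c₁) = viaDiagonal (Any.map onLow
    (sep (low< a) (low< b) (low< c) (low-≢ a₁≡b₁ a≢b) (low-≢ a₁≡c₁ a≢c) (low-≢ (trans (sym a₁≡b₁) a₁≡c₁) b≢c)))
    where
    onLow : ∀ {σ} → Tops M σ (a % M) (b % M) (c % M) → Tops (M * M) (lex M σ σ) a b c
    onLow {σ} (σ< , b<a , c<a) =
      lex-below σ< σ< , lex-< σ σ σ< (inj₂ (sym a₁≡b₁ , b<a)) , lex-< σ σ σ< (inj₂ (sym a₁≡c₁ , c<a))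
  byHighDigits (yes a₁≡b₁) (no a₁≢c₁) =
    let (e₁ , c₁<a₁) = orient-choose (high< a<M²) (high< c<M²) a₁≢c₁
        (e₂ , b₂<a₂) = orient-choose (low< a) (low< b) (low-≢ a₁≡b₁ a≢b)
    in viaOrientation e₁ e₂ (inj₂ (sym a₁≡b₁ , b₂<a₂)) (inj₁ c₁<a₁)
  byHighDigits (no a₁≢b₁) (yes a₁≡c₁) =
    let (e₁ , b₁<a₁) = orient-choose (high< a<M²) (high< b<M²) a₁≢b₁
        (e₂ , c₂<a₂) = orient-choose (low< a) (low< c) (low-≢ a₁≡c₁ a≢c)
    in viaOrientation e₁ e₂ (inj₁ b₁<a₁) (inj₂ (sym a₁≡c₁ , c₂<a₂))
  byHighDigits (no a₁≢b₁) (no a₁≢c₁) with b₁ ≟ c₁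
  ... | yes b₁≡c₁ =
    let (e₁ , b₁<a₁) = orient-choose (high< a<M²) (high< b<M²) a₁≢b₁
    in viaOrientation e₁ true (inj₁ b₁<a₁) (inj₁ (subst (λ u → orient e₁ M u < orient e₁ M a₁) b₁≡c₁ b₁<a₁))
  ... | no b₁≢c₁ = viaDiagonal (Any.map onHigh (sep (high< a<M²) (high< b<M²) (high< c<M²) a₁≢b₁ a₁≢c₁ b₁≢c₁))
    where
    onHigh : ∀ {σ} → Tops M σ a₁ b₁ c₁ → Tops (M * M) (lex M σ σ) a b c
    onHigh {σ} (σ< , b<a , c<a) = lex-below σ< σ< , lex-< σ σ σ< (inj₁ b<a) , lex-< σ σ σ< (inj₁ c<a)

-- m k = 2^(2^k): the sizes reached by squaring k times, starting from 2.
m : ℕ → ℕ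
m k = 2 ^ (2 ^ k)

m-nonZero : ∀ k → NonZero (m k)
m-nonZero k = m^n≢0 2 (2 ^ k)

m-suc : ∀ k → m (suc k) ≡ m k * m k
m-suc k = begin
  2 ^ (2 ^ k + (2 ^ k + 0))   ≡⟨ cong (λ e → 2 ^ (2 ^ k + e)) (+-identityʳ (2 ^ k)) ⟩
  2 ^ (2 ^ k + 2 ^ k)         ≡⟨ ^-distribˡ-+-* 2 (2 ^ k) (2 ^ k) ⟩
  m k * m k                   ∎
  where open ≡-Reasoning

family : ℕ → List (ℕ → ℕ)
family zero = []
family (suc k) = square (m k) {{m-nonZero k}} (family k)

length-family : ∀ k → length (family k) ≡ 4 * k
length-family zero = refl
length-family (suc k) = begin
  length (square (m k) {{m-nonZero k}} (family k))   ≡⟨ length-square {{m-nonZero k}} (family k) ⟩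
  length (family k) + 4                               ≡⟨ cong (_+ 4) (length-family k) ⟩
  4 * k + 4                                           ≡⟨ +-comm (4 * k) 4 ⟩
  4 + 4 * k                                           ≡⟨ *-suc 4 k ⟨
  4 * suc k                                           ∎
  where open ≡-Reasoning

separating-family : ∀ k → Separating (m k) (family k)
separating-family zero = separating-2
separating-family (suc k) = subst (λ M → Separating M (family (suc k))) (sym (m-suc k))
  (square-separating {{m-nonZero k}} (separating-family k))

treesFromKeys : ∀ n {M} fs → suc n ≤ M → Separating M fs →
  ∃[ T ] (ValidFamily (suc n) T × length T ≡ length fs)
treesFromKeys n {M} fs n<M sep = map tree fs , (phylo , covers) , length-map tree fs
  where
  keyed : (f : ℕ → ℕ) → ∃[ t ] (leaves t ↭ allFin (suc n) ×
    (∀ {a b c} → f (toℕ b) < f (toℕ a) → f (toℕ c) < f (toℕ a) → ConsistentWith t a b c))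
  keyed f = Caterpillar.keyTree (f ∘ toℕ) _ _

  tree : (ℕ → ℕ) → Tree (Fin (suc n))
  tree f = proj₁ (keyed f)

  phylo : All (IsPhylo (suc n)) (map tree fs)
  phylo = Allₚ.map⁺ (All.universal (λ f → proj₁ (proj₂ (keyed f))) fs)

  below : (x : Fin (suc n)) → toℕ x < M
  below x = <-≤-trans (toℕ<n x) n<M

  consistent : ∀ {f a b c} → Tops M f (toℕ a) (toℕ b) (toℕ c) → ConsistentWith (tree f) a b c
  consistent {f} (_ , b<a , c<a) = proj₂ (proj₂ (keyed f)) b<a c<a

  covers : Covers (suc n) (map tree fs)
  covers a b c (a≢b , a≢c , b≢c) = Anyₚ.map⁺ (Any.map consistent
    (sep (below a) (below b) (below c) (a≢b ∘ toℕ-injective) (a≢c ∘ toℕ-injective) (b≢c ∘ toℕ-injective)))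

record Ranking (A : Set) : Set₁ where
  field
    _≺_ : A → A → Set
    _≺?_ : ∀ x y → Dec (x ≺ y)
    ≺-trans : ∀ {x y z} → x ≺ y → y ≺ z → x ≺ z
    ≺-connex : ∀ {x y} → x ≢ y → x ≺ y ⊎ y ≺ x

Monotone : {A : Set} → Ranking A → List A → Set
Monotone R ys = AllPairs _≺_ ys ⊎ AllPairs (flip _≺_) ys
  where open Ranking R

AllPairs-⊆ : ∀ {A : Set} {_~_ : A → A → Set} {xs ys} → xs ⊆ ys → AllPairs _~_ ys → AllPairs _~_ xs
AllPairs-⊆ [] [] = []
AllPairs-⊆ (_ ∷ʳ xs⊆ys) (_ ∷ pairs) = AllPairs-⊆ xs⊆ys pairs
AllPairs-⊆ (refl ∷ xs⊆ys) (x~ys ∷ pairs) = All-resp-⊆ xs⊆ys x~ys ∷ AllPairs-⊆ xs⊆ys pairs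

monotone-⊆ : ∀ {A : Set} {R : Ranking A} {xs ys} → xs ⊆ ys → Monotone R ys → Monotone R xs
monotone-⊆ xs⊆ys = Sum.map (AllPairs-⊆ xs⊆ys) (AllPairs-⊆ xs⊆ys)

-- The Erdős–Szekeres theorem, by patience sorting.  The list is read from the right;
-- each new element x goes on the first pile with no element above x, or opens a new
-- pile.  The piles are decreasing, and every element of the i-th pile starts an
-- increasing subsequence of length i.  So k·k elements give k piles or a pile of size k.
module ErdosSzekeres {A : Set} (R : Ranking A) where
  open Ranking R

  ChainFrom : List A → ℕ → A → Set
  ChainFrom L h y = ∃[ c ] ((y ∷ c) ⊆ L × AllPairs _≺_ (y ∷ c) × h ≤ length (y ∷ c))

  record Pile (L : List A) (h : ℕ) (P : List A) : Set where
    field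
      pile-⊆ : P ⊆ L
      decreasing : AllPairs (flip _≺_) P
      nonempty : P ≢ []
      chains : All (ChainFrom L h) P

  -- Piles L h Ps: the i-th pile of Ps (from 0) has chains of length h + i.
  Piles : List A → ℕ → List (List A) → Set
  Piles L h [] = ⊤
  Piles L h (P ∷ Ps) = Pile L h P × Piles L (suc h) Ps

  size : List (List A) → ℕ
  size Ps = sum (map length Ps)

  chain-⊆ : ∀ {L L' h y} → L ⊆ L' → ChainFrom L h y → ChainFrom L' h y
  chain-⊆ L⊆L' (c , sub , inc , long) = c , ⊆-trans sub L⊆L' , inc , long

  piles-⊆ : ∀ {L L' h} Ps → L ⊆ L' → Piles L h Ps → Piles L' h Ps
  piles-⊆ [] _ tt = tt
  piles-⊆ (P ∷ Ps) L⊆L' (pile , piles) = record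
    { pile-⊆ = ⊆-trans (Pile.pile-⊆ pile) L⊆L'
    ; decreasing = Pile.decreasing pile
    ; nonempty = Pile.nonempty pile
    ; chains = All.map (chain-⊆ L⊆L') (Pile.chains pile)
    } , piles-⊆ Ps L⊆L' piles

  chain-∷ : ∀ {L h x y} → x ≺ y → ChainFrom L h y → ChainFrom (x ∷ L) (suc h) x
  chain-∷ x≺y (c , sub , (y≺c ∷ inc) , long) =
    _ ∷ c , refl ∷ sub , (x≺y ∷ All.map (≺-trans x≺y) y≺c) ∷ y≺c ∷ inc , s≤s long

  above-all : ∀ {x P} → All (x ≢_) P → ¬ Any (x ≺_) P → All (_≺ x) P
  above-all [] _ = []
  above-all (x≢y ∷ x≢P) x⊀P with ≺-connex x≢y
  ... | inj₁ x≺y = ⊥-elim (x⊀P (here x≺y))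
  ... | inj₂ y≺x = y≺x ∷ above-all x≢P (x⊀P ∘ there)

  place : ∀ {L h x} Ps → All (x ≢_) L → ChainFrom (x ∷ L) h x → Piles L h Ps →
    ∃[ Ps' ] (Piles (x ∷ L) h Ps' × size Ps' ≡ suc (size Ps))
  place {L} {x = x} [] _ chain tt =
    (x ∷ []) ∷ [] , (record { pile-⊆ = refl ∷ minimum L ; decreasing = [] ∷ [] ; nonempty = λ ()
                            ; chains = chain ∷ [] } , tt) , refl
  place {L} {x = x} (P ∷ Ps) x∉L chain (pile , piles) with any? (x ≺?_) P
  ... | yes x≺P =
    let (Ps' , piles' , size≡) = place Ps x∉L (chainAbove x≺P (Pile.chains pile)) piles
    in P ∷ Ps' , (proj₁ (piles-⊆ (P ∷ []) (x ∷ʳ ⊆-refl) (pile , tt)) , piles') ,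
       trans (cong (length P +_) size≡) (+-suc (length P) (size Ps))
    where
    chainAbove : ∀ {h Q} → Any (x ≺_) Q → All (ChainFrom L h) Q → ChainFrom (x ∷ L) (suc h) x
    chainAbove (here x≺y) (c ∷ _) = chain-∷ x≺y c
    chainAbove (there x≺Q) (_ ∷ cs) = chainAbove x≺Q cs
  ... | no x⊀P =
    (x ∷ P) ∷ Ps , (record
      { pile-⊆ = refl ∷ Pile.pile-⊆ pile
      ; decreasing = above-all (All-resp-⊆ (Pile.pile-⊆ pile) x∉L) x⊀P ∷ Pile.decreasing pile
      ; nonempty = λ ()
      ; chains = chain ∷ All.map (chain-⊆ (x ∷ʳ ⊆-refl)) (Pile.chains pile)
      } , piles-⊆ Ps (x ∷ʳ ⊆-refl) piles) , refl

  patience : ∀ xs → Unique xs → ∃[ Ps ] (Piles xs 1 Ps × size Ps ≡ length xs)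
  patience [] [] = [] , tt , refl
  patience (x ∷ xs) (x∉xs ∷ unique) with patience xs unique
  ... | Ps , piles , size≡ with place Ps x∉xs ([] , refl ∷ minimum xs , [] ∷ [] , ≤-refl) piles
  ... | Ps' , piles' , size≡' = Ps' , piles' , trans size≡' (cong suc size≡)

  lastChain : ∀ {L h P} Ps → Piles L h (P ∷ Ps) → ∃[ y ] ChainFrom L (length Ps + h) y
  lastChain {P = []} [] (pile , _) = ⊥-elim (Pile.nonempty pile refl)
  lastChain {P = y ∷ _} [] (pile , _) with Pile.chains pile
  ... | chain ∷ _ = y , chain
  lastChain {L} {h} (Q ∷ Qs) (_ , piles) =
    let (y , chain) = lastChain Qs piles
    in y , subst (λ l → ChainFrom L l y) (+-suc (length Qs) h) chain

  increasingFromPiles : ∀ {L} Ps → Piles L 1 Ps → ∃[ ys ] (ys ⊆ L × length Ps ≤ length ys × AllPairs _≺_ ys)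
  increasingFromPiles {L} [] _ = [] , minimum L , z≤n , []
  increasingFromPiles (P ∷ Ps) piles =
    let (y , c , sub , inc , long) = lastChain Ps piles
    in y ∷ c , sub , subst (_≤ length (y ∷ c)) (+-comm (length Ps) 1) long , inc

  pileWith : ∀ {L h} {Q : List A → Set} Ps → Piles L h Ps → Any Q Ps →
    ∃[ P ] (Q P × P ⊆ L × AllPairs (flip _≺_) P)
  pileWith (P ∷ _) (pile , _) (here qP) = P , qP , Pile.pile-⊆ pile , Pile.decreasing pile
  pileWith (_ ∷ Ps) (_ , piles) (there qPs) = pileWith Ps piles qPs

  size-≤ : ∀ {s} Ps → All (λ P → length P ≤ s) Ps → size Ps ≤ length Ps * s
  size-≤ [] [] = z≤n
  size-≤ (P ∷ Ps) (P≤s ∷ Ps≤s) = +-mono-≤ P≤s (size-≤ Ps Ps≤s)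

  erdosSzekeres : ∀ k xs → Unique xs → k * k ≤ length xs →
    ∃[ ys ] (ys ⊆ xs × k ≤ length ys × Monotone R ys)
  erdosSzekeres zero xs _ _ = [] , minimum xs , z≤n , inj₁ []
  erdosSzekeres (suc s) xs unique big with patience xs unique
  ... | Ps , piles , size≡ with All.search (λ P → suc s ≤? length P) Ps
  ... | inj₂ long-pile =
    let (P , long , sub , decr) = pileWith Ps piles long-pile in P , sub , long , inj₂ decr
  ... | inj₁ short with suc s ≤? length Ps
  ...   | yes many =
    let (ys , sub , long , inc) = increasingFromPiles Ps piles in ys , sub , ≤-trans many long , inj₁ inc
  ...   | no few = ⊥-elim (<⇒≱ (*-mono-< (n<1+n s) (n<1+n s)) (begin
    suc s * suc s     ≤⟨ big ⟩
    length xs         ≡⟨ size≡ ⟨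
    size Ps           ≤⟨ size-≤ Ps (All.map (≤-pred ∘ ≰⇒>) short) ⟩
    length Ps * s     ≤⟨ *-monoˡ-≤ s (≤-pred (≰⇒> few)) ⟩
    s * s             ∎))
    where open ≤-Reasoning

-- Iterating Erdős–Szekeres over j rankings: m (j + k) distinct elements contain m k
-- elements monotone in every ranking, as m (j + 1 + k) = m (j + k)².
monotoneSublist : ∀ {A : Set} k (Rs : List (Ranking A)) xs → Unique xs → m (length Rs + k) ≤ length xs →
  ∃[ ys ] (ys ⊆ xs × m k ≤ length ys × All (λ R → Monotone R ys) Rs)
monotoneSublist k [] xs _ big = xs , ⊆-refl , big , []
monotoneSublist k (R ∷ Rs) xs unique big
  with ErdosSzekeres.erdosSzekeres R (m (length Rs + k)) xs unique
         (subst (_≤ length xs) (m-suc (length Rs + k)) big)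
... | ys₁ , ys₁⊆xs , long₁ , mono₁ with monotoneSublist k Rs ys₁ (AllPairs-⊆ ys₁⊆xs unique) long₁
... | ys , ys⊆ys₁ , long , monos = ys , ⊆-trans ys⊆ys₁ ys₁⊆xs , long , monotone-⊆ {R = R} ys⊆ys₁ mono₁ ∷ monos

module LeafOrder {n : ℕ} (t : Tree (Fin n)) (φ : IsPhylo n t) where

  leafOf : (x : Fin n) → ∃[ p ] LeafAt t p x
  leafOf x = leafAt t (∈-resp-↭ (↭-sym φ) (∈-allFin x))

  address : Fin n → Addr
  address = proj₁ ∘ leafOf

  ranking : Ranking (Fin n)
  ranking = record
    { _≺_ = λ x y → address x ◁ address y
    ; _≺?_ = λ x y → address x ◁? address y
    ; ≺-trans = ◁-trans
    ; ≺-connex = leaves-◁ (proj₂ (leafOf _)) (proj₂ (leafOf _))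
    }

  monotone-inconsistent : ∀ {x y z r} → Monotone ranking (x ∷ y ∷ z ∷ r) → ¬ ConsistentWith t y x z
  monotone-inconsistent {x} {y} {z} (inj₁ ((x◁y ∷ _) ∷ (y◁z ∷ _) ∷ _)) consistent =
    consistent _ _ _ (proj₂ (leafOf y)) (proj₂ (leafOf x)) (proj₂ (leafOf z)) (◁-between x◁y y◁z)
  monotone-inconsistent {x} {y} {z} (inj₂ ((y◁x ∷ _) ∷ (z◁y ∷ _) ∷ _)) consistent =
    consistent _ _ _ (proj₂ (leafOf y)) (proj₂ (leafOf x)) (proj₂ (leafOf z)) (meets-sym (◁-between z◁y y◁x))

leafRankings : ∀ {n} T → All (IsPhylo n) T → List (Ranking (Fin n))
leafRankings [] [] = []
leafRankings (t ∷ T) (φ ∷ φs) = LeafOrder.ranking t φ ∷ leafRankings T φs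

length-leafRankings : ∀ {n} T (φs : All (IsPhylo n) T) → length (leafRankings T φs) ≡ length T
length-leafRankings [] [] = refl
length-leafRankings (t ∷ T) (φ ∷ φs) = cong suc (length-leafRankings T φs)

monotone-uncovered : ∀ {n} T (φs : All (IsPhylo n) T) {x y z r} →
  All (λ R → Monotone R (x ∷ y ∷ z ∷ r)) (leafRankings T φs) → ¬ Any (λ t → ConsistentWith t y x z) T
monotone-uncovered (t ∷ T) (φ ∷ φs) (mono ∷ _) (here consistent) = LeafOrder.monotone-inconsistent t φ mono consistent
monotone-uncovered (t ∷ T) (φ ∷ φs) (_ ∷ monos) (there covered) = monotone-uncovered T φs monos covered

lowerBound : ∀ n T → ValidFamily n T → n < m (length T + 1)
lowerBound n T (φs , covers) with m (length T + 1) ≤? n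
... | no small = ≰⇒> small
... | yes big with monotoneSublist 1 (leafRankings T φs) (allFin n) (allFin⁺ n) enough
  where
  enough : m (length (leafRankings T φs) + 1) ≤ length (allFin n)
  enough = subst₂ (λ k l → m (k + 1) ≤ l) (sym (length-leafRankings T φs)) (sym (length-tabulate (λ i → i))) big
... | x ∷ y ∷ z ∷ _ , sub , _ , monos with AllPairs-⊆ sub (allFin⁺ n)
...   | (x≢y ∷ x≢z ∷ _) ∷ (y≢z ∷ _) ∷ _ =
  ⊥-elim (monotone-uncovered T φs monos (covers y x z (x≢y ∘ sym , y≢z , x≢z)))
lowerBound n T _ | yes _ | _ ∷ [] , _ , s≤s () , _
lowerBound n T _ | yes _ | _ ∷ _ ∷ [] , _ , s≤s (s≤s ()) , _

⌊log₂⌋-≤ : ∀ {n} e → n ≤ 2 ^ e → ⌊log₂ n ⌋ ≤ e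
⌊log₂⌋-≤ {n} e n≤2^e = subst (⌊log₂ n ⌋ ≤_) (⌊log₂[2^n]⌋≡n e) (⌊log₂⌋-mono-≤ n≤2^e)

<2^suc⌊log₂⌋ : ∀ n → n < 2 ^ suc ⌊log₂ n ⌋
<2^suc⌊log₂⌋ n with 2 ^ suc ⌊log₂ n ⌋ ≤? n
... | no 2^≰n = ≰⇒> 2^≰n
... | yes 2^≤n = ⊥-elim (<-irrefl refl
  (subst (_≤ ⌊log₂ n ⌋) (⌊log₂[2^n]⌋≡n (suc ⌊log₂ n ⌋)) (⌊log₂⌋-mono-≤ 2^≤n)))

loglog-≤ : ∀ {n} k → n ≤ m k → loglog n ≤ k
loglog-≤ k n≤m = ⌊log₂⌋-≤ k (⌊log₂⌋-≤ (2 ^ k) n≤m)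

≤-m-suc-loglog : ∀ n → n ≤ m (suc (loglog n))
≤-m-suc-loglog n = <⇒≤ (<-≤-trans (<2^suc⌊log₂⌋ n) (^-monoʳ-≤ 2 (<2^suc⌊log₂⌋ ⌊log₂ n ⌋)))

1≤loglog : ∀ {n} → 4 ≤ n → 1 ≤ loglog n
1≤loglog 4≤n = ⌊log₂⌋-mono-≤ (⌊log₂⌋-mono-≤ 4≤n)

upperBound : ∀ n → 4 ≤ n → ∃[ T ] (ValidFamily n T × length T ≤ 8 * loglog n)
upperBound n@(suc n') 4≤n =
  let (T , valid , length≡) = treesFromKeys n' (family K) (≤-m-suc-loglog n) (separating-family K)
  in T , valid , (begin
    length T          ≡⟨ trans length≡ (length-family K) ⟩
    4 * K             ≡⟨ *-suc 4 (loglog n) ⟩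
    4 + 4 * loglog n  ≤⟨ +-monoˡ-≤ (4 * loglog n) (*-monoʳ-≤ 4 (1≤loglog 4≤n)) ⟩
    4 * loglog n + 4 * loglog n   ≡⟨ *-distribʳ-+ (loglog n) 4 4 ⟨
    8 * loglog n      ∎)
  where
  K = suc (loglog n)
  open ≤-Reasoning

-- Lower bound: n < m (|T| + 1) gives loglog n ≤ |T| + 1, and |T| ≥ 1 since n ≥ m 1.
loglog-≤-size : ∀ n T → 4 ≤ n → ValidFamily n T → loglog n ≤ 2 * length T
loglog-≤-size n [] 4≤n valid = ⊥-elim (<⇒≱ (lowerBound n [] valid) 4≤n)
loglog-≤-size n T@(_ ∷ T') 4≤n valid = begin
  loglog n          ≤⟨ loglog-≤ (length T + 1) (<⇒≤ (lowerBound n T valid)) ⟩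
  length T + 1      ≤⟨ +-monoʳ-≤ (length T) (s≤s z≤n) ⟩
  length T + (length T + 0)   ≡⟨⟩
  2 * length T      ∎
  where open ≤-Reasoning

theorem5p7 : ∃[ A ] ∃[ B ] ∃[ N ] (∀ (n : ℕ) → N ≤ n →
    (∃[ T ] (ValidFamily n T × length T ≤ B * loglog n))
    × (∀ T → ValidFamily n T → loglog n ≤ A * length T))
theorem5p7 = 2 , 8 , 4 , λ n 4≤n → upperBound n 4≤n , λ T → loglog-≤-size n T 4≤n
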